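{- Let $\mathfrak{A}=(A,(P_\sigma),f_1,f_2)$ be a $2$-data structure over $\Sigma$, let $a,b\in A$ and $j\in\{1,2\}$. Then: (1) $(b,j)\in B_1(a)$ iff there is $i\in\{1,2\}$ with $f_i(a)=f_j(b)$; (2) $(b,j)\in B_2(a)$ iff there exist $i,k\in\{1,2\}$ with $f_i(a)=f_k(b)$.
   Context: A $2$-data structure over a finite set $\Sigma$ of unary predicates is $\mathfrak{A}=(A,(P_\sigma)_{\sigma\in\Sigma},f_1,f_2)$, $A$ nonempty finite, $P_\sigma\subseteq A$, $f_1,f_2:A\to\mathbb{N}$. With $\Gamma_2=\{\sim_{(i,j)}:i,j\in\{1,2\}\}$, the data graph of $\mathfrak{A}$ has vertex set $A\times\{1,2\}$ and a directed edge from $(a,i)$ to $(b,j)$ iff either $a=b$ and $i\ne j$, or $f_i(a)=f_j(b)$. The distance between vertices is the length of a shortest directed path, and $B_r(a)$ is the set of vertices $(b,j)$ whose distance from $(a,i)$ is at most $r$ for some $i\in\{1,2\}$. -}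

module Defs where

open import Data.Nat using (ℕ; zero; suc; _≤_)
open import Data.Fin using (Fin)
open import Data.Bool using (Bool)
open import Data.Product using (_×_; Σ; ∃-syntax; _,_)
open import Data.Sum using (_⊎_)
open import Relation.Binary.PropositionalEquality using (_≡_; _≢_)

-- A 2-data structure over a finite set Σ of unary predicates (Σ = Fin s).
-- The universe A is Fin (suc n): finite and nonempty.
record DataStructure2 (s : ℕ) : Set where
  field
    n : ℕ
    P : Fin s → Fin (suc n) → Bool
    f : Fin 2 → Fin (suc n) → ℕ          -- f i = f_{i+1}

  Elem : Set
  Elem = Fin (suc n)

  Vertex : Set
  Vertex = Elem × Fin 2

  Edge : Vertex → Vertex → Set
  Edge (a , i) (b , j) = (a ≡ b × i ≢ j) ⊎ (f i a ≡ f j b)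

  data Walk : ℕ → Vertex → Vertex → Set where
    here : ∀ {v} → Walk zero v v
    step : ∀ {k u w v} → Edge u w → Walk k w v → Walk (suc k) u v

  DistLe : Vertex → Vertex → ℕ → Set
  DistLe u v r = ∃[ k ] (k ≤ r × Walk k u v)

  InBall : ℕ → Elem → Vertex → Set
  InBall r a w = ∃[ i ] DistLe (a , i) w r

{-# OPTIONS --safe #-}
module Submission where

-- Every edge into (b , j) starting at an element a witnesses some f i a ≡ f j b:
-- a data edge by definition, a copy edge because it stays at a.  Composing two
-- such edges therefore relates a value of a to a value of b.  Conversely a data
-- edge reaches b at some copy k, and one copy edge then moves to (b , j).

open import Defs
open import Data.Nat using (ℕ; _+_; _≤_; z≤n; s≤s)
open import Data.Nat.Properties using (+-mono-≤)
open import Data.Fin using (Fin)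
open import Data.Fin.Properties using (_≟_)
open import Data.Product using (_×_; _,_; ∃-syntax)
open import Data.Sum using (inj₁; inj₂)
open import Function.Bundles using (_⇔_; mk⇔)
open import Relation.Nullary using (yes; no)
open import Relation.Binary.PropositionalEquality using (_≡_; refl; trans)

module DataGraph {s : ℕ} (𝔄 : DataStructure2 s) where
  open DataStructure2 𝔄

  ReachesValue : Elem → Vertex → Set
  ReachesValue a (b , j) = ∃[ i ] f i a ≡ f j b

  SharesValue : Elem → Elem → Set
  SharesValue a b = ∃[ i ] ∃[ k ] f i a ≡ f k b

  reachesValue⇒sharesValue : ∀ {a b j} → ReachesValue a (b , j) → SharesValue a b
  reachesValue⇒sharesValue {j = j} (i , e) = i , j , e

  edge⇒reachesValue : ∀ {a i w} → Edge (a , i) w → ReachesValue a w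
  edge⇒reachesValue {w = _ , j} (inj₁ (refl , _)) = j , refl
  edge⇒reachesValue {i = i}     (inj₂ e)          = i , e

  reachesValue-edge : ∀ {a c l b j} → ReachesValue a (c , l) → Edge (c , l) (b , j) → SharesValue a b
  reachesValue-edge {l = l} (i , e) (inj₁ (refl , _)) = i , l , e
  reachesValue-edge {j = j} (i , e) (inj₂ e′)         = i , j , trans e e′

  walk≤1⇒reachesValue : ∀ {k a i w} → k ≤ 1 → Walk k (a , i) w → ReachesValue a w
  walk≤1⇒reachesValue {i = i} _ here                = i , refl
  walk≤1⇒reachesValue _         (step e here)       = edge⇒reachesValue e
  walk≤1⇒reachesValue (s≤s ())  (step _ (step _ _))

  walk≤2⇒sharesValue : ∀ {k a i b j} → k ≤ 2 → Walk k (a , i) (b , j) → SharesValue a b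
  walk≤2⇒sharesValue {j = j} _      here                         = j , j , refl
  walk≤2⇒sharesValue _              (step e here)                = reachesValue⇒sharesValue (edge⇒reachesValue e)
  walk≤2⇒sharesValue _              (step e (step e′ here))      = reachesValue-edge (edge⇒reachesValue e) e′
  walk≤2⇒sharesValue (s≤s (s≤s ())) (step _ (step _ (step _ _)))

  walk-++ : ∀ {k l u v w} → Walk k u v → Walk l v w → Walk (k + l) u w
  walk-++ here       q = q
  walk-++ (step e p) q = step e (walk-++ p q)

  distLe-trans : ∀ {r r′ u v w} → DistLe u v r → DistLe v w r′ → DistLe u w (r + r′)
  distLe-trans (k , k≤r , p) (l , l≤r′ , q) = k + l , +-mono-≤ k≤r l≤r′ , walk-++ p q

  edge⇒distLe : ∀ {u v} → Edge u v → DistLe u v 1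
  edge⇒distLe e = 1 , s≤s z≤n , step e here

  distLe-copies : ∀ b k j → DistLe (b , k) (b , j) 1
  distLe-copies b k j with k ≟ j
  ... | yes refl = 0 , z≤n , here
  ... | no k≢j   = edge⇒distLe (inj₁ (refl , k≢j))

  inBall1⇔reachesValue : ∀ a b j → InBall 1 a (b , j) ⇔ ReachesValue a (b , j)
  inBall1⇔reachesValue a b j = mk⇔
    (λ (_ , _ , k≤1 , p) → walk≤1⇒reachesValue k≤1 p)
    (λ (i , e) → i , edge⇒distLe (inj₂ e))

  inBall2⇔sharesValue : ∀ a b j → InBall 2 a (b , j) ⇔ SharesValue a b
  inBall2⇔sharesValue a b j = mk⇔
    (λ (_ , _ , k≤2 , p) → walk≤2⇒sharesValue k≤2 p)
    (λ (i , k , e) → i , distLe-trans (edge⇒distLe (inj₂ e)) (distLe-copies b k j))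

lemma4p2 : ∀ {s : ℕ} (𝔄 : DataStructure2 s) →
    let open DataStructure2 𝔄 in
    ∀ (a b : Elem) (j : Fin 2) →
      (InBall 1 a (b , j) ⇔ (∃[ i ] f i a ≡ f j b))
      × (InBall 2 a (b , j) ⇔ (∃[ i ] ∃[ k ] f i a ≡ f k b))
lemma4p2 𝔄 a b j = inBall1⇔reachesValue a b j , inBall2⇔sharesValue a b j
  where open DataGraph 𝔄
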